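{- Let $G$ be a connected graph with a $(0,2)$-partition $(K^1,K^2)$, and let $H$ be the transversal subgraph of $G$ with respect to $(K^1,K^2)$. Then $G$ is $2$-admissible if and only if $G$ has a universal vertex, or $G$ has a cut-vertex, or $H$ is a strict $2$-connected graph with no induced $C_4$.
   Context: All graphs are finite and simple. A $(0,2)$-partition of $G$ is a partition $(K^1,K^2)$ of $V(G)$ into two cliques. A transversal edge is an edge with one endpoint in $K^1$ and the other in $K^2$; the transversal subgraph of $G$ with respect to $(K^1,K^2)$ is the subgraph induced by the vertices incident to at least one transversal edge. A cut-vertex is a vertex whose removal disconnects the graph. A strict $2$-connected graph is one that is $2$-connected but not $3$-connected. A tree $t$-spanner of $G$ is a spanning tree $T$ with $d_T(u,v)\le t$ for every edge $uv$ of $G$; $G$ is $t$-admissible if it has a tree $t$-spanner. -}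

module Defs where

open import Data.Nat using (ℕ; zero; suc; _≤_; _<_)
open import Data.Fin using (Fin)
open import Data.Bool using (Bool; true; false; not)
open import Data.List using (List; []; _∷_; length; _∷ʳ_)
open import Data.List.Relation.Unary.All using (All)
open import Data.List.Relation.Unary.Unique.Propositional using (Unique)
open import Data.List.Membership.Propositional using (_∉_)
open import Data.Product using (Σ; ∃; ∃-syntax; _×_; _,_)
open import Data.Sum using (_⊎_)
open import Data.Unit using (⊤)
open import Relation.Nullary using (¬_)
open import Relation.Binary.PropositionalEquality using (_≡_; _≢_)

record Graph (n : ℕ) : Set where
  field
    E      : Fin n → Fin n → Bool
    sym    : ∀ u v → E u v ≡ E v u
    irrefl : ∀ v → E v v ≡ false

open Graph public

Adj : ∀ {n} → Graph n → Fin n → Fin n → Set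
Adj G u v = E G u v ≡ true

VSet : ℕ → Set₁
VSet n = Fin n → Set

AllV : ∀ {n} → VSet n
AllV _ = ⊤

data Walk {n} (G : Graph n) (S : VSet n) : Fin n → Fin n → Set where
  here : ∀ {u} → S u → Walk G S u u
  step : ∀ {u w v} → S u → Adj G u w → Walk G S w v → Walk G S u v

Connected : ∀ {n} → Graph n → VSet n → Set
Connected G S = (∃[ v ] S v) × (∀ u v → S u → S v → Walk G S u v)

Minus : ∀ {n} → VSet n → List (Fin n) → VSet n
Minus S X v = S v × v ∉ X

AtLeast : ∀ {n} → VSet n → ℕ → Set
AtLeast {n} S m = Σ (List (Fin n)) λ xs → length xs ≡ m × Unique xs × All S xs

KConnected : ∀ {n} → ℕ → Graph n → VSet n → Set
KConnected {n} k G S =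
  AtLeast S (suc k) × (∀ (X : List (Fin n)) → Unique X → length X < k → Connected G (Minus S X))

StrictTwoConnected : ∀ {n} → Graph n → VSet n → Set
StrictTwoConnected G S = KConnected 2 G S × ¬ KConnected 3 G S

InducedC4 : ∀ {n} → Graph n → VSet n → Set
InducedC4 {n} G S = Σ (Fin n) λ a → Σ (Fin n) λ b → Σ (Fin n) λ c → Σ (Fin n) λ d →
  (S a × S b × S c × S d) ×
  (a ≢ b × a ≢ c × a ≢ d × b ≢ c × b ≢ d × c ≢ d) ×
  (Adj G a b × Adj G b c × Adj G c d × Adj G d a) ×
  (¬ Adj G a c × ¬ Adj G b d)

Clique : ∀ {n} → Graph n → (Fin n → Bool) → Set
Clique G K = ∀ u v → K u ≡ true → K v ≡ true → u ≢ v → Adj G u v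

ZeroTwoPartition : ∀ {n} → Graph n → (Fin n → Bool) → (Fin n → Bool) → Set
ZeroTwoPartition G K1 K2 = Clique G K1 × Clique G K2 × (∀ v → K1 v ≡ not (K2 v))

-- vertices incident to a transversal edge; the transversal subgraph is G[this set]
TransversalVertices : ∀ {n} → Graph n → (Fin n → Bool) → (Fin n → Bool) → VSet n
TransversalVertices G K1 K2 v =
  ∃[ u ] Adj G v u × ((K1 v ≡ true × K2 u ≡ true) ⊎ (K2 v ≡ true × K1 u ≡ true))

UniversalVertex : ∀ {n} → Graph n → Fin n → Set
UniversalVertex G v = ∀ u → u ≢ v → Adj G v u

CutVertex : ∀ {n} → Graph n → Fin n → Set
CutVertex G x = ∃[ u ] ∃[ w ] (u ≢ x × w ≢ x × ¬ Walk G (λ v → v ≢ x) u w)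

PathList : ∀ {n} → Graph n → List (Fin n) → Set
PathList G [] = ⊤
PathList G (x ∷ []) = ⊤
PathList G (x ∷ y ∷ r) = Adj G x y × PathList G (y ∷ r)

Cycle : ∀ {n} → Graph n → Fin n → List (Fin n) → Set
Cycle G x xs = 2 ≤ length xs × Unique (x ∷ xs) × PathList G ((x ∷ xs) ∷ʳ x)

Acyclic : ∀ {n} → Graph n → Set
Acyclic G = ∀ x xs → ¬ Cycle G x xs

data WalkLen {n} (G : Graph n) : Fin n → Fin n → ℕ → Set where
  here : ∀ {u} → WalkLen G u u zero
  step : ∀ {u w v k} → Adj G u w → WalkLen G w v k → WalkLen G u v (suc k)

DistLe : ∀ {n} → Graph n → Fin n → Fin n → ℕ → Set
DistLe G u v t = ∃[ k ] k ≤ t × WalkLen G u v k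

SpanningTree : ∀ {n} → Graph n → Graph n → Set
SpanningTree G T = (∀ u v → Adj T u v → Adj G u v) × Connected T AllV × Acyclic T

TreeSpanner : ∀ {n} → ℕ → Graph n → Graph n → Set
TreeSpanner t G T = SpanningTree G T × (∀ u v → Adj G u v → DistLe T u v t)

Admissible : ∀ {n} → ℕ → Graph n → Set
Admissible {n} t G = Σ (Graph n) λ T → TreeSpanner t G T

{-# OPTIONS --safe #-}
-- Call a transversal edge ab covering if every transversal edge pq with p on the side of a
-- has p = a or q = b. Then G is 2-admissible iff it has a universal vertex or a covering edge.
-- The star at a universal vertex and the double star on a covering edge (a joined to the rest
-- of its side, b to everything else) are tree 2-spanners. Conversely, a tree 2-spanner T has no
-- cycle of length at most 6, so each side lies in the closed T-neighbourhood of one vertex; a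
-- centre lying off its own side is universal, and otherwise T has a unique edge between the
-- sides, which is covering.
-- A covering edge ab makes a and b adjacent to all of H. If all transversal edges pass through
-- a, then b is universal or a is a cut-vertex (symmetrically for b). Otherwise H is 2-connected,
-- {a, b} separates it, and an induced C4 of H would avoid a and b and hence lie in one clique.
-- Conversely, all transversal edges pass through a cut-vertex; and without a covering edge or
-- an induced C4, no pair of vertices separates H, so H cannot be strictly 2-connected.

module Submission where

open import Defs
open import Data.Nat using (zero; suc; _<_; s≤s; z≤n)
open import Data.Fin using (Fin; _≟_)
open import Data.Fin.Properties using (any?)
open import Data.Bool using (Bool; true; false; not)
open import Data.Bool.Properties using (¬-not; not-¬; not-involutive) renaming (_≟_ to _≟ᵇ_)
open import Data.List using ([]; _∷_; length)
open import Data.List.Relation.Unary.All using ([]; _∷_)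
open import Data.List.Relation.Unary.AllPairs using ([]; _∷_)
open import Data.List.Relation.Unary.Unique.Propositional using (Unique)
open import Data.List.Relation.Unary.Any using (here; there)
open import Data.List.Membership.Propositional using (_∈_; _∉_)
open import Data.Product using (∃-syntax; _×_; _,_; proj₁; proj₂)
open import Data.Sum using (_⊎_; inj₁; inj₂; [_,_]; [_,_]′; map₂)
open import Data.Unit using (tt)
open import Data.Empty using (⊥; ⊥-elim)
open import Relation.Nullary using (¬_; Dec; yes; no; does; proof)
open import Relation.Nullary.Decidable
  using (toSum; _×-dec_; _⊎-dec_; ¬?; dec-true; dec-false; does-⇔; decidable-stable)
open import Relation.Nullary.Reflects using (Reflects; invert)
open import Relation.Binary.PropositionalEquality
  using (_≡_; _≢_; refl; trans; cong; subst; ≢-sym) renaming (sym to ≡-sym)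
open import Function.Bundles using (_⇔_; mk⇔)

≢-≢⇒≡ : ∀ {x y z : Bool} → x ≢ z → y ≢ z → x ≡ y
≢-≢⇒≡ {true}  {true}  _ _ = refl
≢-≢⇒≡ {false} {false} _ _ = refl
≢-≢⇒≡ {true}  {false} {true}  x≢z _ = ⊥-elim (x≢z refl)
≢-≢⇒≡ {true}  {false} {false} _ y≢z = ⊥-elim (y≢z refl)
≢-≢⇒≡ {false} {true}  {true}  _ y≢z = ⊥-elim (y≢z refl)
≢-≢⇒≡ {false} {true}  {false} x≢z _ = ⊥-elim (x≢z refl)

∉-pair : ∀ {n} {v x y : Fin n} → v ≢ x → v ≢ y → v ∉ x ∷ y ∷ []
∉-pair v≢x _ (here v≡x) = v≢x v≡x
∉-pair _ v≢y (there (here v≡y)) = v≢y v≡y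

module _ {n} (G : Graph n) where

  Adj? : ∀ u v → Dec (Adj G u v)
  Adj? u v = E G u v ≟ᵇ true

  adj-sym : ∀ {u v} → Adj G u v → Adj G v u
  adj-sym {u} {v} uv = trans (Graph.sym G v u) uv

  adj⇒≢ : ∀ {u v} → Adj G u v → u ≢ v
  adj⇒≢ {u} uu refl with trans (≡-sym uu) (irrefl G u)
  ... | ()

module _ {n} {G : Graph n} {S : VSet n} where

  walk-source : ∀ {u v} → Walk G S u v → S u
  walk-source (here su) = su
  walk-source (step su _ _) = su

  walk-trans : ∀ {u v w} → Walk G S u v → Walk G S v w → Walk G S u w
  walk-trans (here _) q = q
  walk-trans (step su uw p) q = step su uw (walk-trans p q)

  walk-sym : ∀ {u v} → Walk G S u v → Walk G S v u
  walk-sym (here sv) = here sv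
  walk-sym (step su uw p) = walk-trans (walk-sym p) (step (walk-source p) (adj-sym G uw) (here su))

  hub⇒connected : ∀ h → S h → (∀ v → S v → v ≢ h → Adj G h v) → Connected G S
  hub⇒connected h sh hub = (h , sh) , λ u v su sv → walk-trans (toHub u su) (walk-sym (toHub v sv))
    where
    toHub : ∀ u → S u → Walk G S u h
    toHub u su with u ≟ h
    ... | yes refl = here su
    ... | no u≢h = step su (adj-sym G (hub u su u≢h)) (here sh)

  walk-leaves-class : ∀ (f : Fin n → Bool) {u v} → Walk G S u v → f v ≢ f u →
                      ∃[ x ] ∃[ y ] (S x × S y × Adj G x y × f x ≡ f u × f y ≢ f u)
  walk-leaves-class f (here _) fv≢fu = ⊥-elim (fv≢fu refl)
  walk-leaves-class f {u} (step {w = w} su uw p) fv≢fu with f w ≟ᵇ f u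
  ... | no fw≢fu = u , w , su , walk-source p , uw , refl , fw≢fu
  ... | yes fw≡fu with walk-leaves-class f p (λ fv≡fw → fv≢fu (trans fv≡fw fw≡fu))
  ...   | x , y , sx , sy , xy , fx≡fw , fy≢fw =
          x , y , sx , sy , xy , trans fx≡fw fw≡fu , λ fy≡fu → fy≢fw (trans fy≡fu (≡-sym fw≡fu))

ClosedNbhd : ∀ {n} → Graph n → Fin n → Fin n → Set
ClosedNbhd T c v = v ≡ c ⊎ Adj T c v

Within2 : ∀ {n} → Graph n → Fin n → Fin n → Set
Within2 T u v = Adj T u v ⊎ ∃[ m ] (Adj T u m × Adj T m v)

module _ {n} (T : Graph n) where

  closedNbhd⇒distLe2 : ∀ {c u v} → ClosedNbhd T c u → ClosedNbhd T c v → DistLe T u v 2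
  closedNbhd⇒distLe2 (inj₁ refl) (inj₁ refl) = 0 , z≤n , here
  closedNbhd⇒distLe2 (inj₁ refl) (inj₂ cv) = 1 , s≤s z≤n , step cv here
  closedNbhd⇒distLe2 (inj₂ cu) (inj₁ refl) = 1 , s≤s z≤n , step (adj-sym T cu) here
  closedNbhd⇒distLe2 (inj₂ cu) (inj₂ cv) = 2 , s≤s (s≤s z≤n) , step (adj-sym T cu) (step cv here)

  distLe2⇒within2 : ∀ {u v} → u ≢ v → DistLe T u v 2 → Within2 T u v
  distLe2⇒within2 u≢v (zero , _ , here) = ⊥-elim (u≢v refl)
  distLe2⇒within2 _ (suc zero , _ , step uv here) = inj₁ uv
  distLe2⇒within2 _ (suc (suc zero) , _ , step um (step mv here)) = inj₂ (_ , um , mv)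
  distLe2⇒within2 _ (suc (suc (suc _)) , s≤s (s≤s ()) , _)

  closedNbhd-path : ∀ {c u x} → ClosedNbhd T c u → ClosedNbhd T c x → u ≢ x →
                    Adj T u x ⊎ (Adj T u c × Adj T c x)
  closedNbhd-path (inj₁ refl) (inj₁ refl) u≢x = ⊥-elim (u≢x refl)
  closedNbhd-path (inj₁ refl) (inj₂ cx) _ = inj₁ cx
  closedNbhd-path (inj₂ cu) (inj₁ refl) _ = inj₁ (adj-sym T cu)
  closedNbhd-path (inj₂ cu) (inj₂ cx) _ = inj₂ (adj-sym T cu , cx)

module _ {n} {T : Graph n} (acyclic : Acyclic T) where

  no-triangle : ∀ {a b c} → Adj T a b → Adj T b c → Adj T c a → ⊥
  no-triangle ab bc ca = acyclic _ (_ ∷ _ ∷ [])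
    ( s≤s (s≤s z≤n)
    , (adj⇒≢ T ab ∷ ≢-sym (adj⇒≢ T ca) ∷ []) ∷ (adj⇒≢ T bc ∷ []) ∷ [] ∷ []
    , ab , bc , ca , tt )

  no-square : ∀ {a b c d} → a ≢ c → b ≢ d →
              Adj T a b → Adj T b c → Adj T c d → Adj T d a → ⊥
  no-square a≢c b≢d ab bc cd da = acyclic _ (_ ∷ _ ∷ _ ∷ [])
    ( s≤s (s≤s z≤n)
    , (adj⇒≢ T ab ∷ a≢c ∷ ≢-sym (adj⇒≢ T da) ∷ []) ∷ (adj⇒≢ T bc ∷ b≢d ∷ [])
      ∷ (adj⇒≢ T cd ∷ []) ∷ [] ∷ []
    , ab , bc , cd , da , tt )

  no-pentagon : ∀ {a b c d e} → a ≢ c → a ≢ d → b ≢ d → b ≢ e → c ≢ e →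
                Adj T a b → Adj T b c → Adj T c d → Adj T d e → Adj T e a → ⊥
  no-pentagon a≢c a≢d b≢d b≢e c≢e ab bc cd de ea = acyclic _ (_ ∷ _ ∷ _ ∷ _ ∷ [])
    ( s≤s (s≤s z≤n)
    , (adj⇒≢ T ab ∷ a≢c ∷ a≢d ∷ ≢-sym (adj⇒≢ T ea) ∷ [])
      ∷ (adj⇒≢ T bc ∷ b≢d ∷ b≢e ∷ []) ∷ (adj⇒≢ T cd ∷ c≢e ∷ []) ∷ (adj⇒≢ T de ∷ []) ∷ [] ∷ []
    , ab , bc , cd , de , ea , tt )

  no-hexagon : ∀ {a b c d e f} → a ≢ c → a ≢ d → a ≢ e → b ≢ d → b ≢ e → b ≢ f →
               c ≢ e → c ≢ f → d ≢ f →
               Adj T a b → Adj T b c → Adj T c d → Adj T d e → Adj T e f → Adj T f a → ⊥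
  no-hexagon a≢c a≢d a≢e b≢d b≢e b≢f c≢e c≢f d≢f ab bc cd de ef fa =
    acyclic _ (_ ∷ _ ∷ _ ∷ _ ∷ _ ∷ [])
    ( s≤s (s≤s z≤n)
    , (adj⇒≢ T ab ∷ a≢c ∷ a≢d ∷ a≢e ∷ ≢-sym (adj⇒≢ T fa) ∷ [])
      ∷ (adj⇒≢ T bc ∷ b≢d ∷ b≢e ∷ b≢f ∷ []) ∷ (adj⇒≢ T cd ∷ c≢e ∷ c≢f ∷ [])
      ∷ (adj⇒≢ T de ∷ d≢f ∷ []) ∷ (adj⇒≢ T ef ∷ []) ∷ [] ∷ []
    , ab , bc , cd , de , ef , fa , tt )

  within2-of-ends⇒closedNbhd : ∀ {u c v w} → Adj T u c → Adj T c v → u ≢ v →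
                                Within2 T w u → Within2 T w v → ClosedNbhd T c w
  within2-of-ends⇒closedNbhd {u} {c} {v} {w} uc cv u≢v wu wv with w ≟ c | Adj? T c w
  ... | yes w≡c | _ = inj₁ w≡c
  ... | no _ | yes cw = inj₂ cw
  ... | no w≢c | no ¬cw = ⊥-elim (circuit wu wv)
    -- the two short walks from w close a cycle of length at most 6 through u – c – v
    where
    ¬uv : ∀ {x y} → Adj T x c → Adj T c y → ¬ Adj T x y
    ¬uv xc cy xy = no-triangle xc cy (adj-sym T xy)

    ≢c : ∀ {m} → Adj T w m → m ≢ c
    ≢c wm refl = ¬cw (adj-sym T wm)

    end≢w : ∀ {u} → Adj T u c → u ≢ w
    end≢w uc refl = ¬cw (adj-sym T uc)

    short-long : ∀ {u v m} → Adj T u c → Adj T c v → u ≢ v → Adj T w u → Adj T w m → Adj T m v → ⊥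
    short-long uc cv u≢v wu wm mv =
      no-pentagon u≢v (λ { refl → ¬uv uc cv mv }) (≢-sym (≢c wm)) (≢-sym w≢c) (end≢w (adj-sym T cv))
        uc cv (adj-sym T mv) (adj-sym T wm) wu

    circuit : Within2 T w u → Within2 T w v → ⊥
    circuit (inj₁ wu) (inj₁ wv) = no-square u≢v (≢-sym w≢c) uc cv (adj-sym T wv) wu
    circuit (inj₁ wu) (inj₂ (_ , wm , mv)) = short-long uc cv u≢v wu wm mv
    circuit (inj₂ (_ , wm , mu)) (inj₁ wv) = short-long (adj-sym T cv) (adj-sym T uc) (≢-sym u≢v) wv wm mu
    circuit (inj₂ (m , wm , mu)) (inj₂ (m' , wm' , m'v)) with m ≟ m'
    ... | yes refl = no-square u≢v (≢-sym (≢c wm)) uc cv (adj-sym T m'v) mu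
    ... | no m≢m' =
          no-hexagon u≢v (λ { refl → ¬uv uc cv m'v }) (end≢w uc) (≢-sym (≢c wm')) (≢-sym w≢c) (≢-sym (≢c wm))
            (end≢w (adj-sym T cv)) (λ { refl → ¬uv uc cv (adj-sym T mu) }) (≢-sym m≢m')
            uc cv (adj-sym T m'v) (adj-sym T wm') wm mu

  module _ (f : Fin n → Bool) {c d : Fin n} (fc≢fd : f c ≢ f d)
           (starC : ∀ w → f w ≡ f c → ClosedNbhd T c w)
           (starD : ∀ w → f w ≡ f d → ClosedNbhd T d w) where

    private
      apart : ∀ {a b} → f a ≡ f c → f b ≡ f d → a ≢ b
      apart fa fb refl = fc≢fd (trans (≡-sym fa) fb)

      two-neighbours : ∀ {z y v e} → Adj T z y → Adj T z v → y ≢ v → z ≢ e →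
                       Adj T y v ⊎ (Adj T y e × Adj T e v) → ⊥
      two-neighbours zy zv _ _ (inj₁ yv) = no-triangle zy yv (adj-sym T zv)
      two-neighbours zy zv y≢v z≢e (inj₂ (ye , ev)) = no-square z≢e y≢v zy ye ev (adj-sym T zv)

    crossing-edge-unique : ∀ {x y u v} → f x ≡ f c → f y ≡ f d → f u ≡ f c → f v ≡ f d →
                           Adj T x y → Adj T u v → u ≡ x × v ≡ y
    crossing-edge-unique {x} {y} {u} {v} fx fy fu fv xy uv with u ≟ x | v ≟ y
    ... | yes u≡x | yes v≡y = u≡x , v≡y
    ... | yes refl | no v≢y =
          ⊥-elim (two-neighbours xy uv (≢-sym v≢y) (apart fx refl)
                    (closedNbhd-path T (starD y fy) (starD v fv) (≢-sym v≢y)))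
    ... | no u≢x | yes refl =
          ⊥-elim (two-neighbours (adj-sym T uv) (adj-sym T xy) u≢x (≢-sym (apart refl fv))
                    (closedNbhd-path T (starC u fu) (starC x fx) u≢x))
    ... | no u≢x | no v≢y =
          -- the edges x y and u v close a cycle of length at most 6 through c and d
          ⊥-elim (circuit (closedNbhd-path T (starC u fu) (starC x fx) u≢x)
                          (closedNbhd-path T (starD y fy) (starD v fv) (≢-sym v≢y)))
      where
      circuit : Adj T u x ⊎ (Adj T u c × Adj T c x) → Adj T y v ⊎ (Adj T y d × Adj T d v) → ⊥
      circuit (inj₁ ux) (inj₁ yv) = no-square (apart fu fy) (apart fx fv) ux xy yv (adj-sym T uv)
      circuit (inj₂ (uc , cx)) (inj₁ yv) =
        no-pentagon u≢x (apart fu fy) (apart refl fy) (apart refl fv) (apart fx fv) uc cx xy yv (adj-sym T uv)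
      circuit (inj₁ ux) (inj₂ (yd , dv)) =
        no-pentagon (apart fu fy) (apart fu refl) (apart fx refl) (apart fx fv) (≢-sym v≢y) ux xy yd dv (adj-sym T uv)
      circuit (inj₂ (uc , cx)) (inj₂ (yd , dv)) =
        no-hexagon u≢x (apart fu fy) (apart fu refl) (apart refl fy) (apart refl refl) (apart refl fv)
          (apart fx refl) (apart fx fv) (≢-sym v≢y) uc cx xy yd dv (adj-sym T uv)

module _ {n} (T : Graph n) (a b : Fin n)
         (leaf : ∀ {v w w'} → v ≢ a → v ≢ b → Adj T v w → Adj T v w' → w ≡ w') where

  private
    branch : ∀ {v w w'} → Adj T v w → Adj T v w' → w ≢ w' → v ≡ a ⊎ v ≡ b
    branch {v} vw vw' w≢w' with v ≟ a | v ≟ b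
    ... | yes v≡a | _ = inj₁ v≡a
    ... | no _ | yes v≡b = inj₂ v≡b
    ... | no v≢a | no v≢b = ⊥-elim (w≢w' (leaf v≢a v≢b vw vw'))

    pigeonhole : ∀ {x y z} → x ≡ a ⊎ x ≡ b → y ≡ a ⊎ y ≡ b → z ≡ a ⊎ z ≡ b →
                 x ≢ y → x ≢ z → y ≢ z → ⊥
    pigeonhole (inj₁ refl) (inj₁ refl) _ x≢y _ _ = x≢y refl
    pigeonhole (inj₂ refl) (inj₂ refl) _ x≢y _ _ = x≢y refl
    pigeonhole (inj₁ refl) _ (inj₁ refl) _ x≢z _ = x≢z refl
    pigeonhole (inj₂ refl) _ (inj₂ refl) _ x≢z _ = x≢z refl
    pigeonhole _ (inj₁ refl) (inj₁ refl) _ _ y≢z = y≢z refl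
    pigeonhole _ (inj₂ refl) (inj₂ refl) _ _ y≢z = y≢z refl

  -- A cycle has three distinct vertices, each with two distinct neighbours.
  two-branch-vertices⇒acyclic : Acyclic T
  two-branch-vertices⇒acyclic x [] (() , _)
  two-branch-vertices⇒acyclic x (_ ∷ []) (s≤s () , _)
  two-branch-vertices⇒acyclic x (v₁ ∷ v₂ ∷ [])
    (_ , (x≢v₁ ∷ x≢v₂ ∷ []) ∷ (v₁≢v₂ ∷ []) ∷ _ , xv₁ , v₁v₂ , v₂x , _) =
    pigeonhole (branch (adj-sym T xv₁) v₁v₂ x≢v₂) (branch (adj-sym T v₁v₂) v₂x (≢-sym x≢v₁))
               (branch xv₁ (adj-sym T v₂x) v₁≢v₂) v₁≢v₂ (≢-sym x≢v₁) (≢-sym x≢v₂)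
  two-branch-vertices⇒acyclic x (v₁ ∷ v₂ ∷ v₃ ∷ [])
    (_ , (_ ∷ x≢v₂ ∷ _) ∷ (v₁≢v₂ ∷ v₁≢v₃ ∷ []) ∷ (v₂≢v₃ ∷ []) ∷ _ , xv₁ , v₁v₂ , v₂v₃ , v₃x , _) =
    pigeonhole (branch (adj-sym T xv₁) v₁v₂ x≢v₂) (branch (adj-sym T v₁v₂) v₂v₃ v₁≢v₃)
               (branch (adj-sym T v₂v₃) v₃x (≢-sym x≢v₂)) v₁≢v₂ v₁≢v₃ v₂≢v₃
  two-branch-vertices⇒acyclic x (v₁ ∷ v₂ ∷ v₃ ∷ v₄ ∷ _)
    (_ , (_ ∷ x≢v₂ ∷ _) ∷ (v₁≢v₂ ∷ v₁≢v₃ ∷ _) ∷ (v₂≢v₃ ∷ v₂≢v₄ ∷ _) ∷ _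
       , xv₁ , v₁v₂ , v₂v₃ , v₃v₄ , _) =
    pigeonhole (branch (adj-sym T xv₁) v₁v₂ x≢v₂) (branch (adj-sym T v₁v₂) v₂v₃ v₁≢v₃)
               (branch (adj-sym T v₂v₃) v₃v₄ v₂≢v₄) v₁≢v₂ v₁≢v₃ v₂≢v₃

-- The tree with edges v — p v: p ∘ p ≡ r bounds its depth by two, and p-branch confines its
-- non-leaves to {a, b}.
module DepthTwoTree {n} (G : Graph n) (p : Fin n → Fin n) (r a b : Fin n)
  (p∘p≡r : ∀ v → p (p v) ≡ r) (p-branch : ∀ v → p v ≡ a ⊎ p v ≡ b)
  (p-adj : ∀ v → v ≢ p v → Adj G v (p v)) where

  TreeEdge : Fin n → Fin n → Set
  TreeEdge u v = (p u ≡ v ⊎ p v ≡ u) × u ≢ v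

  TreeEdge? : ∀ u v → Dec (TreeEdge u v)
  TreeEdge? u v = ((p u ≟ v) ⊎-dec (p v ≟ u)) ×-dec ¬? (u ≟ v)

  TreeEdge-sym : ∀ {u v} → TreeEdge u v → TreeEdge v u
  TreeEdge-sym (inj₁ pu≡v , u≢v) = inj₂ pu≡v , ≢-sym u≢v
  TreeEdge-sym (inj₂ pv≡u , u≢v) = inj₁ pv≡u , ≢-sym u≢v

  T : Graph n
  T = record
    { E      = λ u v → does (TreeEdge? u v)
    ; sym    = λ u v → does-⇔ (mk⇔ TreeEdge-sym TreeEdge-sym) (TreeEdge? u v) (TreeEdge? v u)
    ; irrefl = λ v → dec-false (TreeEdge? v v) (λ (_ , v≢v) → v≢v refl)
    }

  treeEdge : ∀ {u v} → Adj T u v → TreeEdge u v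
  treeEdge {u} {v} uv = invert (subst (Reflects (TreeEdge u v)) uv (proof (TreeEdge? u v)))

  parent-adj : ∀ {v} → v ≢ p v → Adj T v (p v)
  parent-adj {v} v≢pv = dec-true (TreeEdge? v (p v)) (inj₁ refl , v≢pv)

  parent-closedNbhd : ∀ v → ClosedNbhd T (p v) v
  parent-closedNbhd v with v ≟ p v
  ... | yes v≡pv = inj₁ v≡pv
  ... | no v≢pv = inj₂ (adj-sym T (parent-adj v≢pv))

  private
    toParent : ∀ v → Walk T AllV v (p v)
    toParent v with parent-closedNbhd v
    ... | inj₁ v≡pv = subst (Walk T AllV v) v≡pv (here tt)
    ... | inj₂ pv~v = step tt (adj-sym T pv~v) (here tt)

    toRoot : ∀ v → Walk T AllV v r
    toRoot v = walk-trans (toParent v) (subst (Walk T AllV (p v)) (p∘p≡r v) (toParent (p v)))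

    leaf : ∀ {v w w'} → v ≢ a → v ≢ b → Adj T v w → Adj T v w' → w ≡ w'
    leaf {v} v≢a v≢b vw vw' = trans (neighbour≡parent vw) (≡-sym (neighbour≡parent vw'))
      where
      neighbour≡parent : ∀ {w} → Adj T v w → w ≡ p v
      neighbour≡parent vw with treeEdge vw
      ... | inj₁ pv≡w , _ = ≡-sym pv≡w
      ... | inj₂ pw≡v , _ with p-branch _
      ...   | inj₁ pw≡a = ⊥-elim (v≢a (trans (≡-sym pw≡v) pw≡a))
      ...   | inj₂ pw≡b = ⊥-elim (v≢b (trans (≡-sym pw≡v) pw≡b))

    T⊆G : ∀ u v → Adj T u v → Adj G u v
    T⊆G u v uv with treeEdge uv
    ... | inj₁ refl , u≢v = p-adj u u≢v
    ... | inj₂ refl , u≢v = adj-sym G (p-adj v (≢-sym u≢v))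

  spanningTree : SpanningTree G T
  spanningTree = T⊆G , ((r , tt) , λ u v _ _ → walk-trans (toRoot u) (walk-sym (toRoot v)))
               , two-branch-vertices⇒acyclic T a b leaf

universal⇒admissible : ∀ {n} (G : Graph n) {c} → UniversalVertex G c → Admissible 2 G
universal⇒admissible G {c} universal =
  T , spanningTree , λ u v _ → closedNbhd⇒distLe2 T (parent-closedNbhd u) (parent-closedNbhd v)
  where
  open DepthTwoTree G (λ _ → c) c c c (λ _ → refl) (λ _ → inj₁ refl)
                     (λ v v≢c → adj-sym G (universal v v≢c))

module _ {n} (G T : Graph n) (spans : ∀ u v → Adj G u v → DistLe T u v 2) where

  spanner-within2 : ∀ {u v} → Adj G u v → Within2 T u v
  spanner-within2 {u} {v} uv = distLe2⇒within2 T (adj⇒≢ G uv) (spans u v uv)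

module _ {n} {G T : Graph n} (acyclic : Acyclic T) (spans : ∀ u v → Adj G u v → DistLe T u v 2) where

  clique-centre : (K : Fin n → Set) → (∀ v → Dec (K v)) → (∀ u v → K u → K v → u ≢ v → Adj G u v) →
                  ∀ {u₀} → K u₀ → ∃[ c ] (∀ w → K w → ClosedNbhd T c w)
  clique-centre K K? clique {u₀} ku₀
    with any? (λ u → any? (λ v → K? u ×-dec K? v ×-dec ¬? (u ≟ v) ×-dec ¬? (Adj? T u v)))
  ... | no ¬far = u₀ , centred
    where
    centred : ∀ w → K w → ClosedNbhd T u₀ w
    centred w kw with w ≟ u₀ | Adj? T u₀ w
    ... | yes w≡u₀ | _ = inj₁ w≡u₀
    ... | no _ | yes u₀w = inj₂ u₀w
    ... | no w≢u₀ | no ¬u₀w = ⊥-elim (¬far (u₀ , w , ku₀ , kw , ≢-sym w≢u₀ , ¬u₀w))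
  ... | yes (u , v , ku , kv , u≢v , ¬uv) with spanner-within2 G T spans (clique u v ku kv u≢v)
  ...   | inj₁ uv = ⊥-elim (¬uv uv)
  ...   | inj₂ (c , uc , cv) = c , centred
    where
    centred : ∀ w → K w → ClosedNbhd T c w
    centred w kw with w ≟ u | w ≟ v
    ... | yes refl | _ = inj₂ (adj-sym T uc)
    ... | no _ | yes refl = inj₂ cv
    ... | no w≢u | no w≢v =
          within2-of-ends⇒closedNbhd acyclic uc cv u≢v
            (spanner-within2 G T spans (clique w u kw ku w≢u)) (spanner-within2 G T spans (clique w v kw kv w≢v))

module Partition {n} (G : Graph n) (K1 K2 : Fin n → Bool) (partition : ZeroTwoPartition G K1 K2) where

  H : VSet n
  H = TransversalVertices G K1 K2

  private
    true≢false : true ≢ false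
    true≢false ()

    K1≡false⇒K2≡true : ∀ {w} → K1 w ≡ false → K2 w ≡ true
    K1≡false⇒K2≡true {w} k1w =
      trans (≡-sym (not-involutive (K2 w))) (cong not (trans (≡-sym (proj₂ (proj₂ partition) w)) k1w))

    K2≡true⇒K1≡false : ∀ {w} → K2 w ≡ true → K1 w ≡ false
    K2≡true⇒K1≡false {w} k2w = trans (proj₂ (proj₂ partition) w) (cong not k2w)

    side-≢ : ∀ {u v} → K1 u ≢ K1 v → u ≢ v
    side-≢ ku≢kv refl = ku≢kv refl

  sameSide⇒adj : ∀ {u v} → K1 u ≡ K1 v → u ≢ v → Adj G u v
  sameSide⇒adj {u} {v} ku≡kv u≢v with K1 u in ku
  ... | true  = proj₁ partition u v ku (≡-sym ku≡kv) u≢v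
  ... | false = proj₁ (proj₂ partition) u v (K1≡false⇒K2≡true ku) (K1≡false⇒K2≡true (≡-sym ku≡kv)) u≢v

  sameSide⇒connected : ∀ {S : VSet n} {w} → S w → (∀ v → S v → K1 v ≡ K1 w) → Connected G S
  sameSide⇒connected {w = w} sw sameSide =
    hub⇒connected w sw λ v sv v≢w → sameSide⇒adj (≡-sym (sameSide v sv)) (≢-sym v≢w)

  Transversal : Fin n → Fin n → Set
  Transversal p q = Adj G p q × K1 p ≢ K1 q

  Transversal? : ∀ p q → Dec (Transversal p q)
  Transversal? p q = Adj? G p q ×-dec ¬? (K1 p ≟ᵇ K1 q)

  transversal-sym : ∀ {p q} → Transversal p q → Transversal q p
  transversal-sym (pq , p≁q) = adj-sym G pq , ≢-sym p≁q

  transversal⇒H : ∀ {p q} → Transversal p q → H p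
  transversal⇒H {p} {q} (pq , p≁q) with K1 p in kp
  ... | true  = q , pq , inj₁ (refl , K1≡false⇒K2≡true (¬-not (≢-sym p≁q)))
  ... | false = q , pq , inj₂ (K1≡false⇒K2≡true kp , ¬-not (≢-sym p≁q))

  H⇒transversal : ∀ {v} → H v → ∃[ u ] Transversal v u
  H⇒transversal (u , vu , inj₁ (k1v , k2u)) =
    u , vu , λ kv≡ku → true≢false (trans (≡-sym k1v) (trans kv≡ku (K2≡true⇒K1≡false k2u)))
  H⇒transversal (u , vu , inj₂ (k2v , k1u)) =
    u , vu , λ kv≡ku → true≢false (trans (≡-sym k1u) (trans (≡-sym kv≡ku) (K2≡true⇒K1≡false k2v)))

  TransversalIn : VSet n → Set
  TransversalIn S = ∃[ p ] ∃[ q ] (S p × S q × Transversal p q)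

  transversalIn? : ∀ {S : VSet n} → (∀ v → Dec (S v)) → Dec (TransversalIn S)
  transversalIn? S? = any? (λ p → any? (λ q → S? p ×-dec S? q ×-dec Transversal? p q))

  walk⇒transversalIn : ∀ {S : VSet n} {u v} → Walk G S u v → K1 u ≢ K1 v → TransversalIn S
  walk⇒transversalIn w ku≢kv with walk-leaves-class K1 w (≢-sym ku≢kv)
  ... | x , y , sx , sy , xy , kx≡ku , ky≢ku =
        x , y , sx , sy , xy , λ kx≡ky → ky≢ku (trans (≡-sym kx≡ky) kx≡ku)

  walk-preserves-side : ∀ {S : VSet n} {u v} → ¬ TransversalIn S → Walk G S u v → K1 u ≡ K1 v
  walk-preserves-side {u = u} {v} free w =
    decidable-stable (K1 u ≟ᵇ K1 v) (λ ku≢kv → free (walk⇒transversalIn w ku≢kv))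

  transversalIn⇒connected : ∀ {S : VSet n} → TransversalIn S → Connected G S
  transversalIn⇒connected {S} (p , q , sp , sq , (pq , p≁q)) =
    (p , sp) , λ u v su sv → walk-trans (toP u su) (walk-sym (toP v sv))
    where
    toP : ∀ v → S v → Walk G S v p
    toP v sv with K1 v ≟ᵇ K1 p | v ≟ p | v ≟ q
    ... | yes _ | yes refl | _ = here sv
    ... | yes kv≡kp | no v≢p | _ = step sv (sameSide⇒adj kv≡kp v≢p) (here sp)
    ... | no _ | _ | yes refl = step sv (adj-sym G pq) (here sp)
    ... | no kv≢kp | _ | no v≢q =
          step sv (sameSide⇒adj (≢-≢⇒≡ kv≢kp (≢-sym p≁q)) v≢q) (step sq (adj-sym G pq) (here sp))

  endpoint : ∀ β {p q} → Transversal p q → ∃[ w ] (H w × (w ≡ p ⊎ w ≡ q) × K1 w ≡ β)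
  endpoint β {p} {q} t with K1 p ≟ᵇ β
  ... | yes kp≡β = p , transversal⇒H t , inj₁ refl , kp≡β
  ... | no kp≢β =
        q , transversal⇒H (transversal-sym t) , inj₂ refl , ≢-≢⇒≡ (≢-sym (proj₂ t)) (≢-sym kp≢β)

  Covers : Fin n → Fin n → Set
  Covers a b = ∀ p q → Transversal p q → K1 p ≡ K1 a → p ≡ a ⊎ q ≡ b

  CoveringEdge : Set
  CoveringEdge = ∃[ a ] ∃[ b ] (Transversal a b × Covers a b)

  uncovered⊎covers : ∀ a b →
    (∃[ p ] ∃[ q ] (Transversal p q × K1 p ≡ K1 a × p ≢ a × q ≢ b)) ⊎ Covers a b
  uncovered⊎covers a b
    with any? (λ p → any? (λ q → Transversal? p q ×-dec (K1 p ≟ᵇ K1 a) ×-dec ¬? (p ≟ a) ×-dec ¬? (q ≟ b)))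
  ... | yes uncovered = inj₁ uncovered
  ... | no ¬uncovered = inj₂ covers
    where
    covers : Covers a b
    covers p q t kp with p ≟ a | q ≟ b
    ... | yes p≡a | _ = inj₁ p≡a
    ... | no _ | yes q≡b = inj₂ q≡b
    ... | no p≢a | no q≢b = ⊥-elim (¬uncovered (p , q , t , kp , p≢a , q≢b))

  coveringEdge? : Dec CoveringEdge
  coveringEdge? = any? (λ a → any? (λ b → Transversal? a b ×-dec covers? a b))
    where
    covers? : ∀ a b → Dec (Covers a b)
    covers? a b with uncovered⊎covers a b
    ... | inj₁ (p , q , t , kp , p≢a , q≢b) = no λ covers → [ p≢a , q≢b ] (covers p q t kp)
    ... | inj₂ covers = yes covers

  meets⇒covers : ∀ {a b} → (∀ p q → Transversal p q → p ≡ a ⊎ q ≡ a) → Covers a b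
  meets⇒covers meets p q t kp with meets p q t
  ... | inj₁ p≡a = inj₁ p≡a
  ... | inj₂ refl = ⊥-elim (proj₂ t kp)

  meets⇒coveringEdge : ∀ {a} → (∀ p q → Transversal p q → p ≡ a ⊎ q ≡ a) →
                       ∃[ p ] ∃[ q ] Transversal p q → CoveringEdge
  meets⇒coveringEdge meets (p , q , t) with meets p q t
  ... | inj₁ refl = _ , _ , t , meets⇒covers meets
  ... | inj₂ refl = _ , _ , transversal-sym t , meets⇒covers meets

  covering-end-dominates : ∀ {c d} → Transversal c d → Covers c d → ∀ v → H v → v ≢ c → Adj G c v
  covering-end-dominates {c} {d} (cd , c≁d) covers-cd v hv v≢c with K1 v ≟ᵇ K1 c | H⇒transversal hv
  ... | yes kv≡kc | _ = sameSide⇒adj (≡-sym kv≡kc) (≢-sym v≢c)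
  ... | no kv≢kc | u , vu , v≁u
    with covers-cd u v (adj-sym G vu , ≢-sym v≁u) (≢-≢⇒≡ (≢-sym v≁u) (≢-sym kv≢kc))
  ...   | inj₁ refl = adj-sym G vu
  ...   | inj₂ refl = cd

  module CoveringEdgeAt {a b} (tab : Transversal a b) (covers : Covers a b) where

    private
      a≁b : K1 a ≢ K1 b
      a≁b = proj₂ tab

    covers-sym : Covers b a
    covers-sym p q (pq , p≁q) kp≡kb =
      Data.Sum.swap (covers q p (transversal-sym (pq , p≁q))
                             (≢-≢⇒≡ (λ kq≡kb → p≁q (trans kp≡kb (≡-sym kq≡kb))) a≁b))

    meets : ∀ {p q} → Transversal p q → p ∈ a ∷ b ∷ [] ⊎ q ∈ a ∷ b ∷ []
    meets {p} {q} t with K1 p ≟ᵇ K1 a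
    ... | yes kp≡ka =
          [ (λ p≡a → inj₁ (here p≡a)) , (λ q≡b → inj₂ (there (here q≡b))) ] (covers p q t kp≡ka)
    ... | no kp≢ka =
          [ (λ q≡a → inj₂ (here q≡a)) , (λ p≡b → inj₁ (there (here p≡b))) ]
            (covers q p (transversal-sym t) (≢-≢⇒≡ (≢-sym (proj₂ t)) (≢-sym kp≢ka)))

    a-dominates : ∀ v → H v → v ≢ a → Adj G a v
    a-dominates = covering-end-dominates tab covers

    b-dominates : ∀ v → H v → v ≢ b → Adj G b v
    b-dominates = covering-end-dominates (transversal-sym tab) covers-sym

    private
      parent : Fin n → Fin n
      parent v with v ≟ a | K1 v ≟ᵇ K1 a
      ... | yes _ | _     = b
      ... | no _  | yes _ = a
      ... | no _  | no _  = b

      parent-a : parent a ≡ b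
      parent-a with a ≟ a | K1 a ≟ᵇ K1 a
      ... | yes _ | _ = refl
      ... | no a≢a | _ = ⊥-elim (a≢a refl)

      parent-sameSide : ∀ {v} → K1 v ≡ K1 a → v ≢ a → parent v ≡ a
      parent-sameSide {v} kv≡ka v≢a with v ≟ a | K1 v ≟ᵇ K1 a
      ... | yes v≡a | _ = ⊥-elim (v≢a v≡a)
      ... | no _ | yes _ = refl
      ... | no _ | no kv≢ka = ⊥-elim (kv≢ka kv≡ka)

      parent-otherSide : ∀ {v} → K1 v ≢ K1 a → parent v ≡ b
      parent-otherSide {v} kv≢ka with v ≟ a | K1 v ≟ᵇ K1 a
      ... | yes _ | _ = refl
      ... | no _ | yes kv≡ka = ⊥-elim (kv≢ka kv≡ka)
      ... | no _ | no _ = refl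

      parent-branch : ∀ v → parent v ≡ a ⊎ parent v ≡ b
      parent-branch v with v ≟ a | K1 v ≟ᵇ K1 a
      ... | yes _ | _     = inj₂ refl
      ... | no _  | yes _ = inj₁ refl
      ... | no _  | no _  = inj₂ refl

      parent-b : parent b ≡ b
      parent-b = parent-otherSide (≢-sym a≁b)

      parent∘parent : ∀ v → parent (parent v) ≡ b
      parent∘parent v with parent-branch v
      ... | inj₁ pv≡a = trans (cong parent pv≡a) parent-a
      ... | inj₂ pv≡b = trans (cong parent pv≡b) parent-b

      parent-adj : ∀ v → v ≢ parent v → Adj G v (parent v)
      parent-adj v v≢pv with v ≟ a | K1 v ≟ᵇ K1 a
      ... | yes refl | _ = proj₁ tab
      ... | no v≢a | yes kv≡ka = sameSide⇒adj kv≡ka v≢a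
      ... | no _ | no kv≢ka = sameSide⇒adj (≢-≢⇒≡ kv≢ka (≢-sym a≁b)) v≢pv

    open DepthTwoTree G parent b a b parent∘parent parent-branch parent-adj

    private
      -- Not `with v ≟ a`, which would also abstract the same test inside `parent v`.
      a-side : ∀ {v} → K1 v ≡ K1 a → ClosedNbhd T a v
      a-side {v} kv≡ka =
        [ inj₁
        , (λ v≢a → subst (λ c → ClosedNbhd T c v) (parent-sameSide kv≡ka v≢a) (parent-closedNbhd v))
        ]′ (toSum (v ≟ a))

      b-side : ∀ {v} → K1 v ≢ K1 a → ClosedNbhd T b v
      b-side {v} kv≢ka = subst (λ c → ClosedNbhd T c v) (parent-otherSide kv≢ka) (parent-closedNbhd v)

      a∈N[b] : ClosedNbhd T b a
      a∈N[b] = subst (λ c → ClosedNbhd T c a) parent-a (parent-closedNbhd a)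

      b∈N[a] : ClosedNbhd T a b
      b∈N[a] with a∈N[b]
      ... | inj₁ a≡b = ⊥-elim (a≁b (cong K1 a≡b))
      ... | inj₂ ba = inj₂ (adj-sym T {b} {a} ba)

      transversal-centre : ∀ {u v} → Transversal u v → K1 u ≡ K1 a →
                           ∃[ c ] (ClosedNbhd T c u × ClosedNbhd T c v)
      transversal-centre {u} {v} t ku≡ka with covers u v t ku≡ka
      ... | inj₁ refl = b , a∈N[b] , b-side (λ kv≡ka → proj₂ t (trans ku≡ka (≡-sym kv≡ka)))
      ... | inj₂ refl = a , a-side ku≡ka , b∈N[a]

      common-centre : ∀ u v → Adj G u v → ∃[ c ] (ClosedNbhd T c u × ClosedNbhd T c v)
      common-centre u v uv = centre (K1 u ≟ᵇ K1 a) (K1 v ≟ᵇ K1 a)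
        where
        centre : Dec (K1 u ≡ K1 a) → Dec (K1 v ≡ K1 a) → ∃[ c ] (ClosedNbhd T c u × ClosedNbhd T c v)
        centre (yes ku≡ka) (yes kv≡ka) = a , a-side ku≡ka , a-side kv≡ka
        centre (no ku≢ka) (no kv≢ka) = b , b-side ku≢ka , b-side kv≢ka
        centre (yes ku≡ka) (no kv≢ka) =
          transversal-centre (uv , λ ku≡kv → kv≢ka (trans (≡-sym ku≡kv) ku≡ka)) ku≡ka
        centre (no ku≢ka) (yes kv≡ka)
          with transversal-centre (adj-sym G uv , λ kv≡ku → ku≢ka (trans (≡-sym kv≡ku) kv≡ka)) kv≡ka
        ... | c , cv , cu = c , cu , cv

    admissible : Admissible 2 G
    admissible = T , spanningTree , λ u v uv → let (_ , cu , cv) = common-centre u v uv in closedNbhd⇒distLe2 T cu cv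

    noInducedC4 : ¬ InducedC4 G H
    noInducedC4 (p , q , r , _ , (hp , _ , hr , hs) , (_ , p≢r , _ , _ , q≢s , _) , (pq , qr , _ , _) , (¬pr , ¬qs)) =
      ¬pr (sameSide⇒adj (trans (sameSide p∉ab q∉ab pq) (sameSide q∉ab r∉ab qr)) p≢r)
      where
      outside : ∀ {z z'} → H z' → z ≢ z' → ¬ Adj G z z' → z ∉ a ∷ b ∷ []
      outside hz' z≢z' ¬zz' (here refl) = ¬zz' (a-dominates _ hz' (≢-sym z≢z'))
      outside hz' z≢z' ¬zz' (there (here refl)) = ¬zz' (b-dominates _ hz' (≢-sym z≢z'))

      sameSide : ∀ {z z'} → z ∉ a ∷ b ∷ [] → z' ∉ a ∷ b ∷ [] → Adj G z z' → K1 z ≡ K1 z'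
      sameSide {z} {z'} z∉ab z'∉ab zz' =
        decidable-stable (K1 z ≟ᵇ K1 z') (λ kz≢kz' → [ z∉ab , z'∉ab ] (meets (zz' , kz≢kz')))

      p∉ab : p ∉ a ∷ b ∷ []
      p∉ab = outside hr p≢r ¬pr
      q∉ab : q ∉ a ∷ b ∷ []
      q∉ab = outside hs q≢s ¬qs
      r∉ab : r ∉ a ∷ b ∷ []
      r∉ab = outside hp (≢-sym p≢r) (λ rp → ¬pr (adj-sym G rp))

    private
      hub-minus-connected : ∀ {h X} → H h → h ∉ X → (∀ v → H v → v ≢ h → Adj G h v) →
                            Connected G (Minus H X)
      hub-minus-connected {h} hh h∉X dominates =
        hub⇒connected h (hh , h∉X) λ v (hv , _) v≢h → dominates v hv v≢h

    twoConnected : ∀ {a₂} → H a₂ → K1 a₂ ≡ K1 a → a₂ ≢ a → KConnected 2 G H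
    twoConnected {a₂} ha₂ ka₂ a₂≢a =
      ( a ∷ b ∷ a₂ ∷ [] , refl
      , (side-≢ a≁b ∷ ≢-sym a₂≢a ∷ [])
        ∷ (side-≢ (λ kb≡ka₂ → a≁b (trans (≡-sym ka₂) (≡-sym kb≡ka₂))) ∷ []) ∷ [] ∷ []
      , transversal⇒H tab ∷ transversal⇒H (transversal-sym tab) ∷ ha₂ ∷ [] )
      , removal
      where
      removal : ∀ X → Unique X → length X < 2 → Connected G (Minus H X)
      removal [] _ _ = hub-minus-connected (transversal⇒H tab) (λ ()) a-dominates
      removal (x ∷ []) _ _ with x ≟ a
      ... | yes refl =
            hub-minus-connected (transversal⇒H (transversal-sym tab)) (λ { (here b≡a) → a≁b (cong K1 (≡-sym b≡a)) })
              b-dominates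
      ... | no x≢a = hub-minus-connected (transversal⇒H tab) (λ { (here a≡x) → x≢a (≡-sym a≡x) }) a-dominates
      removal (_ ∷ _ ∷ _) _ (s≤s (s≤s ()))

    notThreeConnected : ∀ {a₂ b₂} → H a₂ → K1 a₂ ≡ K1 a → a₂ ≢ a → H b₂ → K1 b₂ ≡ K1 b → b₂ ≢ b →
                        ¬ KConnected 3 G H
    notThreeConnected {a₂} {b₂} ha₂ ka₂ a₂≢a hb₂ kb₂ b₂≢b (_ , connected) =
      a≁b (trans (≡-sym ka₂) (trans (walk-preserves-side free a₂⇝b₂) kb₂))
      where
      free : ¬ TransversalIn (Minus H (a ∷ b ∷ []))
      free (p , q , (_ , p∉ab) , (_ , q∉ab) , t) = [ p∉ab , q∉ab ] (meets t)

      a₂⇝b₂ : Walk G (Minus H (a ∷ b ∷ [])) a₂ b₂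
      a₂⇝b₂ = proj₂ (connected (a ∷ b ∷ []) ((side-≢ a≁b ∷ []) ∷ [] ∷ []) (s≤s (s≤s (s≤s z≤n))))
                a₂ b₂ (ha₂ , ∉-pair a₂≢a (λ { refl → a≁b (≡-sym ka₂) }))
                      (hb₂ , ∉-pair (λ { refl → a≁b kb₂ }) b₂≢b)

  coveringEdge⇒admissible : CoveringEdge → Admissible 2 G
  coveringEdge⇒admissible (_ , _ , tab , covers) = CoveringEdgeAt.admissible tab covers

  through-vertex⇒universal⊎cut : ∀ {a b} → Transversal a b → ¬ TransversalIn (λ v → v ≢ a) →
                                  (∃[ v ] UniversalVertex G v) ⊎ (∃[ v ] CutVertex G v)
  through-vertex⇒universal⊎cut {a} {b} (ab , a≁b) free with any? (λ v → (K1 v ≟ᵇ K1 a) ×-dec ¬? (v ≟ a))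
  ... | yes (a' , ka'≡ka , a'≢a) =
        inj₂ (a , a' , b , a'≢a , side-≢ (≢-sym a≁b) ,
              λ a'⇝b → a≁b (trans (≡-sym ka'≡ka) (walk-preserves-side free a'⇝b)))
  ... | no ¬a' = inj₁ (b , universal)
    where
    universal : UniversalVertex G b
    universal u u≢b with K1 u ≟ᵇ K1 a | u ≟ a
    ... | _ | yes refl = adj-sym G ab
    ... | yes ku≡ka | no u≢a = ⊥-elim (¬a' (u , ku≡ka , u≢a))
    ... | no ku≢ka | _ = sameSide⇒adj (≢-≢⇒≡ (≢-sym a≁b) ku≢ka) (≢-sym u≢b)

  Criterion : Set
  Criterion = (∃[ v ] UniversalVertex G v) ⊎ (∃[ v ] CutVertex G v) ⊎ (StrictTwoConnected G H × ¬ InducedC4 G H)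

  coveringEdge⇒criterion : CoveringEdge → Criterion
  coveringEdge⇒criterion (a , b , tab , covers)
    with transversalIn? (λ v → ¬? (v ≟ a)) | transversalIn? (λ v → ¬? (v ≟ b))
  ... | no ¬avoid-a | _ = map₂ inj₁ (through-vertex⇒universal⊎cut tab ¬avoid-a)
  ... | yes _ | no ¬avoid-b = map₂ inj₁ (through-vertex⇒universal⊎cut (transversal-sym tab) ¬avoid-b)
  ... | yes (_ , _ , p≢a , q≢a , t) | yes (_ , _ , p'≢b , q'≢b , t')
    with endpoint (K1 a) t | endpoint (K1 b) t'
  ...   | a₂ , ha₂ , a₂∈t , ka₂ | b₂ , hb₂ , b₂∈t' , kb₂ =
          inj₂ (inj₂ ( (twoConnected ha₂ ka₂ a₂≢a , notThreeConnected ha₂ ka₂ a₂≢a hb₂ kb₂ b₂≢b)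
                     , noInducedC4 ))
    where
    open CoveringEdgeAt tab covers
    a₂≢a : a₂ ≢ a
    a₂≢a = [ (λ { refl → p≢a }) , (λ { refl → q≢a }) ] a₂∈t
    b₂≢b : b₂ ≢ b
    b₂≢b = [ (λ { refl → p'≢b }) , (λ { refl → q'≢b }) ] b₂∈t'

  cutVertex⇒coveringEdge : Connected G AllV → ∀ {x} → CutVertex G x → CoveringEdge
  cutVertex⇒coveringEdge (_ , walk) {x} (u , w , u≢x , w≢x , ¬u⇝w) =
    meets⇒coveringEdge meets-x crossing
    where
    free : ¬ TransversalIn (λ v → v ≢ x)
    free tr = ¬u⇝w (proj₂ (transversalIn⇒connected tr) u w u≢x w≢x)

    meets-x : ∀ p q → Transversal p q → p ≡ x ⊎ q ≡ x
    meets-x p q t with p ≟ x | q ≟ x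
    ... | yes p≡x | _ = inj₁ p≡x
    ... | no _ | yes q≡x = inj₂ q≡x
    ... | no p≢x | no q≢x = ⊥-elim (free (p , q , p≢x , q≢x , t))

    u≁w : K1 u ≢ K1 w
    u≁w ku≡kw with u ≟ w
    ... | yes refl = ¬u⇝w (here u≢x)
    ... | no u≢w = ¬u⇝w (step u≢x (sameSide⇒adj ku≡kw u≢w) (here w≢x))

    crossing : ∃[ p ] ∃[ q ] Transversal p q
    crossing with walk⇒transversalIn (walk u w tt tt) u≁w
    ... | p , q , _ , _ , t = p , q , t

  module _ (¬ce : ¬ CoveringEdge) (noC4 : ¬ InducedC4 G H) {p₀ q₀} (t₀ : Transversal p₀ q₀) where

    private
      Avoids : Fin n → Fin n → VSet n
      Avoids x y v = v ≢ x × v ≢ y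

      isolated⇒meets : ∀ {x y} → ¬ TransversalIn (Avoids x y) → ¬ (∃[ q ] Transversal x q) →
                       ∀ p q → Transversal p q → p ≡ y ⊎ q ≡ y
      isolated⇒meets {x} {y} free ¬x p q t with p ≟ x | q ≟ x | p ≟ y | q ≟ y
      ... | yes refl | _ | _ | _ = ⊥-elim (¬x (q , t))
      ... | _ | yes refl | _ | _ = ⊥-elim (¬x (p , transversal-sym t))
      ... | _ | _ | yes p≡y | _ = inj₁ p≡y
      ... | _ | _ | _ | yes q≡y = inj₂ q≡y
      ... | no p≢x | no q≢x | no p≢y | no q≢y = ⊥-elim (free (p , q , (p≢x , p≢y) , (q≢x , q≢y) , t))

      avoids-sym : ∀ {x y} → ¬ TransversalIn (Avoids x y) → ¬ TransversalIn (Avoids y x)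
      avoids-sym free (p , q , (p≢y , p≢x) , (q≢y , q≢x) , t) = free (p , q , (p≢x , p≢y) , (q≢x , q≢y) , t)

      pair-covers : ∀ {x y} → K1 x ≢ K1 y → ¬ TransversalIn (Avoids x y) → Covers x y
      pair-covers {x} {y} x≁y free p q t kp≡kx with p ≟ x | q ≟ y
      ... | yes p≡x | _ = inj₁ p≡x
      ... | no _ | yes q≡y = inj₂ q≡y
      ... | no p≢x | no q≢y =
            ⊥-elim (free ( p , q
                         , (p≢x , side-≢ (λ kp≡ky → x≁y (trans (≡-sym kp≡kx) kp≡ky)))
                         , (side-≢ (λ kq≡kx → proj₂ t (trans kp≡kx (≡-sym kq≡kx))) , q≢y)
                         , t ))

      pair-square : ∀ {x y p q} → K1 x ≢ K1 y → ¬ TransversalIn (Avoids x y) → ¬ Adj G x y →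
                    Transversal x q → Transversal y p → InducedC4 G H
      pair-square {x} {y} {p} {q} x≁y free ¬xy xq yp =
          x , q , y , p
        , ( transversal⇒H xq , transversal⇒H (transversal-sym xq)
          , transversal⇒H yp , transversal⇒H (transversal-sym yp) )
        , (adj⇒≢ G (proj₁ xq) , side-≢ x≁y , ≢-sym p≢x , q≢y , side-≢ q≁p , adj⇒≢ G (proj₁ yp))
        , (proj₁ xq , sameSide⇒adj kq≡ky q≢y , proj₁ yp , sameSide⇒adj kp≡kx p≢x)
        , (¬xy , ¬qp)
        where
        kq≡ky : K1 q ≡ K1 y
        kq≡ky = ≢-≢⇒≡ (≢-sym (proj₂ xq)) (≢-sym x≁y)

        kp≡kx : K1 p ≡ K1 x
        kp≡kx = ≢-≢⇒≡ (≢-sym (proj₂ yp)) x≁y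

        q≢y : q ≢ y
        q≢y refl = ¬xy (proj₁ xq)

        p≢x : p ≢ x
        p≢x refl = ¬xy (adj-sym G (proj₁ yp))

        q≁p : K1 q ≢ K1 p
        q≁p kq≡kp = x≁y (trans (≡-sym kp≡kx) (trans (≡-sym kq≡kp) kq≡ky))

        ¬qp : ¬ Adj G q p
        ¬qp qp = free ( q , p
                      , (side-≢ (λ kq≡kx → x≁y (trans (≡-sym kq≡kx) kq≡ky)) , q≢y)
                      , (p≢x , side-≢ (λ kp≡ky → x≁y (trans (≡-sym kp≡kx) kp≡ky)))
                      , qp , q≁p )

      opposite-pair : ∀ {x y} → K1 x ≢ K1 y → ¬ TransversalIn (Avoids x y) → ⊥
      opposite-pair {x} {y} x≁y free with Adj? G x y | any? (Transversal? x) | any? (Transversal? y)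
      ... | yes xy | _ | _ = ¬ce (x , y , (xy , x≁y) , pair-covers x≁y free)
      ... | no _ | no ¬x | _ = ¬ce (meets⇒coveringEdge (isolated⇒meets free ¬x) (_ , _ , t₀))
      ... | no _ | yes _ | no ¬y = ¬ce (meets⇒coveringEdge (isolated⇒meets (avoids-sym free) ¬y) (_ , _ , t₀))
      ... | no ¬xy | yes (_ , xq) | yes (_ , yp) = noC4 (pair-square x≁y free ¬xy xq yp)

      sameSide-pair : ∀ {x y} → K1 x ≡ K1 y → ¬ TransversalIn (Avoids x y) →
                      Connected G (Minus H (x ∷ y ∷ []))
      sameSide-pair {x} {y} kx≡ky free with endpoint (not (K1 x)) t₀
      ... | w , hw , _ , kw≡¬kx = sameSide⇒connected (hw , ∉-pair (side-≢ w≁x) (side-≢ w≁y)) onSide-w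
        where
        w≁x : K1 w ≢ K1 x
        w≁x kw≡kx = not-¬ refl (trans (≡-sym kw≡kx) kw≡¬kx)
        w≁y : K1 w ≢ K1 y
        w≁y kw≡ky = w≁x (trans kw≡ky (≡-sym kx≡ky))
        onSide-w : ∀ v → Minus H (x ∷ y ∷ []) v → K1 v ≡ K1 w
        onSide-w v (hv , v∉xy) with H⇒transversal hv
        ... | u , t = ≢-≢⇒≡ v≁x w≁x
          where
          v≁x : K1 v ≢ K1 x
          v≁x kv≡kx = free ( v , u
                           , ((λ v≡x → v∉xy (here v≡x)) , (λ v≡y → v∉xy (there (here v≡y))))
                           , ( side-≢ (λ ku≡kx → proj₂ t (trans kv≡kx (≡-sym ku≡kx)))
                             , side-≢ (λ ku≡ky → proj₂ t (trans kv≡kx (trans kx≡ky (≡-sym ku≡ky)))))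
                           , t )

    pair-removal-connected : ∀ x y → Connected G (Minus H (x ∷ y ∷ []))
    pair-removal-connected x y with transversalIn? (λ v → ¬? (v ≟ x) ×-dec ¬? (v ≟ y)) | K1 x ≟ᵇ K1 y
    ... | yes (p , q , (p≢x , p≢y) , (q≢x , q≢y) , t) | _ =
          transversalIn⇒connected (p , q , (transversal⇒H t , ∉-pair p≢x p≢y) ,
                                            (transversal⇒H (transversal-sym t) , ∉-pair q≢x q≢y) , t)
    ... | no free | yes kx≡ky = sameSide-pair kx≡ky free
    ... | no free | no kx≢ky = ⊥-elim (opposite-pair kx≢ky free)

  noCoveringEdge⇒threeConnected : ¬ CoveringEdge → ¬ InducedC4 G H → KConnected 2 G H → KConnected 3 G H
  noCoveringEdge⇒threeConnected ¬ce noC4 (([] , () , _) , _)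
  noCoveringEdge⇒threeConnected ¬ce noC4 ((v ∷ _ , _ , _ , hv ∷ _) , connected) with H⇒transversal hv
  ... | q₀ , t₀ with uncovered⊎covers v q₀
  ...   | inj₂ covers = ⊥-elim (¬ce (v , q₀ , t₀ , covers))
  ...   | inj₁ (p₁ , q₁ , t₁ , kp₁≡kv , p₁≢v , q₁≢q₀) =
          ( v ∷ p₁ ∷ q₀ ∷ q₁ ∷ [] , refl
          , (≢-sym p₁≢v ∷ adj⇒≢ G (proj₁ t₀) ∷ side-≢ v≁q₁ ∷ [])
            ∷ (side-≢ (λ kp₁≡kq₀ → proj₂ t₀ (trans (≡-sym kp₁≡kv) kp₁≡kq₀))
               ∷ adj⇒≢ G (proj₁ t₁) ∷ [])
            ∷ (≢-sym q₁≢q₀ ∷ []) ∷ [] ∷ []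
          , hv ∷ transversal⇒H t₁ ∷ transversal⇒H (transversal-sym t₀)
               ∷ transversal⇒H (transversal-sym t₁) ∷ [] )
          , removal
    where
    v≁q₁ : K1 v ≢ K1 q₁
    v≁q₁ kv≡kq₁ = proj₂ t₁ (trans kp₁≡kv kv≡kq₁)

    removal : ∀ X → Unique X → length X < 3 → Connected G (Minus H X)
    removal [] u _ = connected [] u (s≤s z≤n)
    removal (x ∷ []) u _ = connected (x ∷ []) u (s≤s (s≤s z≤n))
    removal (x ∷ y ∷ []) _ _ = pair-removal-connected ¬ce noC4 t₀ x y
    removal (_ ∷ _ ∷ _ ∷ _) _ (s≤s (s≤s (s≤s ())))

  strict⇒coveringEdge : StrictTwoConnected G H → ¬ InducedC4 G H → CoveringEdge
  strict⇒coveringEdge (twoConnected , ¬threeConnected) noC4 with coveringEdge?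
  ... | yes ce = ce
  ... | no ¬ce = ⊥-elim (¬threeConnected (noCoveringEdge⇒threeConnected ¬ce noC4 twoConnected))

  module _ {T : Graph n} (T⊆G : ∀ u v → Adj T u v → Adj G u v) (T-connected : Connected T AllV)
           (acyclic : Acyclic T) (spans : ∀ u v → Adj G u v → DistLe T u v 2) where

    private
      SideCentre : Fin n → Fin n → Set
      SideCentre v c = ∀ w → K1 w ≡ K1 v → ClosedNbhd T c w

      side-centre : ∀ v → ∃[ c ] SideCentre v c
      side-centre v = clique-centre {G = G} acyclic spans (λ w → K1 w ≡ K1 v) (λ w → K1 w ≟ᵇ K1 v)
                        (λ u w ku kw → sameSide⇒adj (trans ku (≡-sym kw))) refl

      offside-centre⇒universal : ∀ {v c} → SideCentre v c → K1 c ≢ K1 v → UniversalVertex G c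
      offside-centre⇒universal {v} {c} centre kc≢kv u u≢c with K1 u ≟ᵇ K1 v
      ... | no ku≢kv = sameSide⇒adj (≢-≢⇒≡ kc≢kv ku≢kv) (≢-sym u≢c)
      ... | yes ku≡kv with centre u ku≡kv
      ...   | inj₁ u≡c = ⊥-elim (u≢c u≡c)
      ...   | inj₂ cu = T⊆G c u cu

      centres⇒coveringEdge : ∀ {c d} → K1 c ≢ K1 d → SideCentre c c → SideCentre d d → CoveringEdge
      centres⇒coveringEdge {c} {d} c≁d centreC centreD
        with walk-leaves-class K1 (proj₂ T-connected c d tt tt) (≢-sym c≁d)
      ... | x , y , _ , _ , xy , kx≡kc , ky≢kc =
            x , y , (T⊆G x y xy , λ kx≡ky → ky≢kc (trans (≡-sym kx≡ky) kx≡kc)) , covers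
        where
        d-side : ∀ {v} → K1 v ≢ K1 c → K1 v ≡ K1 d
        d-side kv≢kc = ≢-≢⇒≡ kv≢kc (≢-sym c≁d)

        unique : ∀ {u v} → K1 u ≡ K1 c → K1 v ≢ K1 c → Adj T u v → u ≡ x × v ≡ y
        unique ku kv uv = crossing-edge-unique acyclic K1 c≁d centreC centreD kx≡kc (d-side ky≢kc) ku (d-side kv) xy uv

        covers : Covers x y
        covers p q (pq , p≁q) kp≡kx with p ≟ x | q ≟ y
        ... | yes p≡x | _ = inj₁ p≡x
        ... | no _ | yes q≡y = inj₂ q≡y
        ... | no p≢x | no q≢y = ⊥-elim (short-path (spanner-within2 G T spans pq))
          where
          kp≡kc : K1 p ≡ K1 c
          kp≡kc = trans kp≡kx kx≡kc

          kq≢kc : K1 q ≢ K1 c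
          kq≢kc kq≡kc = p≁q (trans kp≡kc (≡-sym kq≡kc))

          short-path : Within2 T p q → ⊥
          short-path (inj₁ pq') = p≢x (proj₁ (unique kp≡kc kq≢kc pq'))
          short-path (inj₂ (m , pm , mq)) with K1 m ≟ᵇ K1 c
          ... | yes km≡kc = q≢y (proj₂ (unique km≡kc kq≢kc mq))
          ... | no km≢kc = p≢x (proj₁ (unique kp≡kc km≢kc pm))

    treeSpanner⇒universal⊎coveringEdge : Fin n → (∃[ v ] UniversalVertex G v) ⊎ CoveringEdge
    treeSpanner⇒universal⊎coveringEdge v₀ with any? (λ w → ¬? (K1 w ≟ᵇ K1 v₀))
    ... | no ¬other = inj₁ (v₀ , λ u u≢v₀ → sameSide⇒adj (same u) (≢-sym u≢v₀))
      where
      same : ∀ u → K1 v₀ ≡ K1 u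
      same u = decidable-stable (K1 v₀ ≟ᵇ K1 u) (λ kv₀≢ku → ¬other (u , ≢-sym kv₀≢ku))
    ... | yes (w , kw≢kv₀) with side-centre v₀ | side-centre w
    ...   | c , centreC | d , centreD with K1 c ≟ᵇ K1 v₀ | K1 d ≟ᵇ K1 w
    ...     | no kc≢kv₀ | _ = inj₁ (c , offside-centre⇒universal centreC kc≢kv₀)
    ...     | yes _ | no kd≢kw = inj₁ (d , offside-centre⇒universal centreD kd≢kw)
    ...     | yes kc≡kv₀ | yes kd≡kw =
              inj₂ (centres⇒coveringEdge (λ kc≡kd → kw≢kv₀ (trans (≡-sym kd≡kw) (trans (≡-sym kc≡kd) kc≡kv₀)))
                                         (λ u ku≡kc → centreC u (trans ku≡kc kc≡kv₀))
                                         (λ u ku≡kd → centreD u (trans ku≡kd kd≡kw)))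

lemma9 : ∀ {n} (G : Graph n) (K1 K2 : Fin n → Bool) →
    Connected G AllV → ZeroTwoPartition G K1 K2 →
    Admissible 2 G ⇔
      ((∃[ v ] UniversalVertex G v) ⊎ (∃[ v ] CutVertex G v) ⊎
       (StrictTwoConnected G (TransversalVertices G K1 K2) × ¬ InducedC4 G (TransversalVertices G K1 K2)))
lemma9 G K1 K2 connected partition = mk⇔ necessary sufficient
  where
  open Partition G K1 K2 partition

  necessary : Admissible 2 G → Criterion
  necessary (T , (T⊆G , T-connected , acyclic) , spans)
    with treeSpanner⇒universal⊎coveringEdge T⊆G T-connected acyclic spans (proj₁ (proj₁ connected))
  ... | inj₁ universal = inj₁ universal
  ... | inj₂ coveringEdge = coveringEdge⇒criterion coveringEdge

  sufficient : Criterion → Admissible 2 G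
  sufficient (inj₁ (_ , universal)) = universal⇒admissible G universal
  sufficient (inj₂ (inj₁ (_ , cut))) = coveringEdge⇒admissible (cutVertex⇒coveringEdge connected cut)
  sufficient (inj₂ (inj₂ (strict , noC4))) = coveringEdge⇒admissible (strict⇒coveringEdge strict noC4)
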